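{- Let $G$ be a finite simple closed graph and let $v$ be a vertex of degree $d=\deg(v)\ge2$. Then the local clustering coefficient satisfies $C_v\ge \frac12-\frac1{2(d-1)}$. Furthermore, if $d\ge3$ then $C_v\ge\frac13$.
   Context: A labeling of $G$ is a bijection $V(G)\to[n]$, identifying $V(G)=[n]$; it is closed if whenever $\{j,i\},\{i,k\}\in E(G)$ with $j\neq k$ and either $j>i<k$ or $j<i>k$, then $\{j,k\}\in E(G)$; $G$ is closed if it has a closed labeling. For $\deg(v)\ge2$, $C_v=\frac{\#\{\text{pairs of neighbors of } v \text{ joined by an edge}\}}{\#\{\text{pairs of neighbors of } v\}}$. -}

module Defs where

open import Data.Bool using (Bool; true; false; T; _∧_)
open import Data.Nat as ℕ using (ℕ; zero; suc; _<ᵇ_)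
open import Data.Nat.Combinatorics using (_C_)
open import Data.Fin using (Fin; toℕ)
open import Data.List using (List; length; filterᵇ; allFin; cartesianProduct)
open import Data.Product using (_×_; _,_; proj₁; proj₂)
open import Data.Sum using (_⊎_)
open import Data.Integer using (+_)
open import Data.Rational using (ℚ; _/_; _-_; ½; 0ℚ)
open import Function.Bundles using (_⤖_; Bijection)
open import Relation.Binary.PropositionalEquality using (_≡_; _≢_)

record SimpleGraph (n : ℕ) : Set where
  field
    adj    : Fin n → Fin n → Bool
    sym    : ∀ u v → adj u v ≡ adj v u
    irrefl : ∀ v → adj v v ≡ false

open SimpleGraph public

Edge : ∀ {n} → SimpleGraph n → Fin n → Fin n → Set
Edge G u v = T (adj G u v)

Labeling : ℕ → Set
Labeling n = Fin n ⤖ Fin n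

IsClosedLabeling : ∀ {n} → SimpleGraph n → Labeling n → Set
IsClosedLabeling {n} G σ =
  ∀ (j i k : Fin n) → Edge G j i → Edge G i k → j ≢ k →
    ((lab i ℕ.< lab j × lab i ℕ.< lab k) ⊎ (lab j ℕ.< lab i × lab k ℕ.< lab i)) →
    Edge G j k
  where
    lab : Fin n → ℕ
    lab x = toℕ (Bijection.to σ x)

IsClosed : ∀ {n} → SimpleGraph n → Set
IsClosed {n} G = Data.Product.Σ (Labeling n) (IsClosedLabeling G)

degree : ∀ {n} → SimpleGraph n → Fin n → ℕ
degree {n} G v = length (filterᵇ (adj G v) (allFin n))

linkedNeighbourPairs : ∀ {n} → SimpleGraph n → Fin n → ℕ
linkedNeighbourPairs {n} G v =
  length (filterᵇ ok (cartesianProduct (allFin n) (allFin n)))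
  where
    ok : Fin n × Fin n → Bool
    ok (u , w) = (toℕ u <ᵇ toℕ w) ∧ adj G v u ∧ adj G v w ∧ adj G u w

neighbourPairs : ∀ {n} → SimpleGraph n → Fin n → ℕ
neighbourPairs G v = degree G v C 2

-- e / p as a rational; the value for p = 0 is a dummy (never used when deg ≥ 2)
ratio : ℕ → ℕ → ℚ
ratio e zero    = 0ℚ
ratio e (suc p) = + e / suc p

clustering : ∀ {n} → SimpleGraph n → Fin n → ℚ
clustering G v = ratio (linkedNeighbourPairs G v) (neighbourPairs G v)

-- 1/2 - 1/(2(d-1)), for d ≥ 2 (dummy value 0 for d < 2)
lowerBound : ℕ → ℚ
lowerBound (suc (suc k)) = ½ - (+ 1 / (2 ℕ.* suc k))
lowerBound _             = 0ℚ

module Submission where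

-- In a closed labeling, the neighbours of v labelled below v are pairwise adjacent, and so are
-- those labelled above v: this is the closedness condition with v as the middle vertex. If a of
-- the d neighbours lie below and b above, at least C(a,2) + C(b,2) neighbour pairs are linked,
-- and 2(a² + b²) ≥ (a + b)² turns this into 4e ≥ d(d − 2). Dividing by C(d,2) = d(d − 1)/2 gives
-- C_v ≥ (d − 2)/(2(d − 1)), which is at least 1/3 once d ≥ 4; for d = 3, 4e ≥ 3 forces e ≥ 1.

open import Defs
open import Data.Nat using (ℕ; _≤_)
open import Data.Fin using (Fin)
open import Data.Product using (_×_)
open import Data.Integer using (+_)
open import Data.Rational using (_/_) renaming (_≤_ to _≤ℚ_)

open import Data.Bool using (Bool; true; false; T; not; _∧_; _∨_)
open import Data.Bool.Properties using (T-∧; T-∨; T-not-≡)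
open import Data.Empty using (⊥-elim)
open import Data.Fin using (toℕ)
import Data.Fin.Properties as Fin
open import Data.Integer as ℤ using (+≤+)
import Data.Integer.Properties as ℤ
open import Data.List using (List; []; _∷_; length; filterᵇ; map; _++_; allFin; cartesianProduct)
open import Data.List.Relation.Unary.All as All using (All; []; _∷_)
open import Data.List.Relation.Unary.AllPairs using (AllPairs; []; _∷_)
open import Data.List.Relation.Unary.AllPairs.Properties using (tabulate⁺-<)
open import Data.Nat as ℕ using (zero; suc; _+_; _*_; _<_; _<ᵇ_; z≤n; s≤s)
open import Data.Nat.Properties as ℕ
  using (≤-reflexive; +-cancelʳ-≤; *-cancelˡ-≤; *-monoʳ-≤; *-monoˡ-≤; +-monoˡ-≤)
open import Data.Nat.Combinatorics using (_C_; nC1≡n; nCk+nC[k+1]≡[n+1]C[k+1])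
open import Data.Nat.Tactic.RingSolver using (solve-∀)
open import Data.Product using (_,_; proj₁; proj₂)
open import Data.Rational as ℚ using (ℚ; ½; _-_; toℚᵘ; fromℚᵘ)
import Data.Rational.Properties as ℚ
open import Data.Rational.Unnormalised as ℚᵘ using (mkℚᵘ; *≤*) renaming (_≤_ to _≤ᵘ_)
import Data.Rational.Unnormalised.Properties as ℚᵘ
open import Data.Sum using (inj₁; inj₂; [_,_]′)
open import Function using (Equivalence)
open import Function.Bundles using (Bijection)
open import Relation.Nullary using (¬_)
open import Relation.Nullary.Decidable using (dec-true; dec-false)
open import Relation.Binary.PropositionalEquality as ≡ hiding (sym)

open Equivalence using (to; from)

[1+m]C2≡m+mC2 : ∀ m → suc m C 2 ≡ m + m C 2
[1+m]C2≡m+mC2 m = trans (≡.sym (nCk+nC[k+1]≡[n+1]C[k+1] m 1)) (cong (_+ m C 2) (nC1≡n m))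

2*[1+m]C2≡[1+m]*m : ∀ m → 2 * (suc m C 2) ≡ suc m * m
2*[1+m]C2≡[1+m]*m zero    = refl
2*[1+m]C2≡[1+m]*m (suc m) = begin
  2 * (suc (suc m) C 2)         ≡⟨ cong (2 *_) ([1+m]C2≡m+mC2 (suc m)) ⟩
  2 * (suc m + suc m C 2)       ≡⟨ distrib (suc m) (suc m C 2) ⟩
  2 * suc m + 2 * (suc m C 2)   ≡⟨ cong (λ x → 2 * suc m + x) (2*[1+m]C2≡[1+m]*m m) ⟩
  2 * suc m + suc m * m         ≡⟨ square m ⟩
  suc (suc m) * suc m           ∎
  where
  open ≡-Reasoning
  distrib : ∀ m c → 2 * (m + c) ≡ 2 * m + 2 * c
  distrib = solve-∀
  square : ∀ m → 2 * suc m + suc m * m ≡ suc (suc m) * suc m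
  square = solve-∀

2*mC2+m≡m*m : ∀ m → 2 * (m C 2) + m ≡ m * m
2*mC2+m≡m*m zero    = refl
2*mC2+m≡m*m (suc m) = trans (cong (_+ suc m) (2*[1+m]C2≡[1+m]*m m)) (square m)
  where
  square : ∀ m → suc m * m + suc m ≡ suc m * suc m
  square = solve-∀

square-+-≤ : ∀ a b → (a + b) * (a + b) ≤ 2 * (a * a) + 2 * (b * b)
square-+-≤ a b = [ ordered , swapped ]′ (ℕ.≤-total a b)
  where
  gap : ∀ a t → (a + (a + t)) * (a + (a + t)) + t * t ≡ 2 * (a * a) + 2 * ((a + t) * (a + t))
  gap = solve-∀
  ordered : ∀ {a b} → a ≤ b → (a + b) * (a + b) ≤ 2 * (a * a) + 2 * (b * b)
  ordered {a} a≤b with t , refl ← ℕ.m≤n⇒∃[o]m+o≡n a≤b =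
    subst ((a + (a + t)) * (a + (a + t)) ≤_) (gap a t) (ℕ.m≤m+n _ (t * t))
  swapped : b ≤ a → (a + b) * (a + b) ≤ 2 * (a * a) + 2 * (b * b)
  swapped b≤a = subst₂ _≤_ (cong (λ s → s * s) (ℕ.+-comm b a))
                           (ℕ.+-comm (2 * (b * b)) (2 * (a * a))) (ordered b≤a)

C2+C2≤⇒square≤ : ∀ a b {e} → a C 2 + b C 2 ≤ e → (a + b) * (a + b) ≤ 4 * e + 2 * (a + b)
C2+C2≤⇒square≤ a b {e} pairs≤e = begin
  (a + b) * (a + b)
    ≤⟨ square-+-≤ a b ⟩
  2 * (a * a) + 2 * (b * b)
    ≡⟨ cong₂ (λ x y → 2 * x + 2 * y) (≡.sym (2*mC2+m≡m*m a)) (≡.sym (2*mC2+m≡m*m b)) ⟩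
  2 * (2 * (a C 2) + a) + 2 * (2 * (b C 2) + b)
    ≡⟨ regroup (a C 2) (b C 2) a b ⟩
  4 * (a C 2 + b C 2) + 2 * (a + b)
    ≤⟨ +-monoˡ-≤ (2 * (a + b)) (*-monoʳ-≤ 4 pairs≤e) ⟩
  4 * e + 2 * (a + b) ∎
  where
  open ℕ.≤-Reasoning
  regroup : ∀ x y a b → 2 * (2 * x + a) + 2 * (2 * y + b) ≡ 4 * (x + y) + 2 * (a + b)
  regroup = solve-∀

count : ∀ {A : Set} → (A → Bool) → List A → ℕ
count p xs = length (filterᵇ p xs)

module _ {A : Set} {p q : A → Bool} where

  count-mono-≤ : (∀ {x} → T (p x) → T (q x)) → ∀ xs → count p xs ≤ count q xs
  count-mono-≤ p⇒q [] = z≤n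
  count-mono-≤ p⇒q (x ∷ xs) with p x | q x | p⇒q {x}
  ... | true  | true  | _      = s≤s (count-mono-≤ p⇒q xs)
  ... | true  | false | px⇒qx = ⊥-elim (px⇒qx _)
  ... | false | true  | _      = ℕ.m≤n⇒m≤1+n (count-mono-≤ p⇒q xs)
  ... | false | false | _      = count-mono-≤ p⇒q xs

  count-∨ : (∀ {x} → T (p x) → ¬ T (q x)) → ∀ xs →
            count (λ x → p x ∨ q x) xs ≡ count p xs + count q xs
  count-∨ disjoint [] = refl
  count-∨ disjoint (x ∷ xs) with p x | q x | disjoint {x}
  ... | true  | true  | px⇒¬qx = ⊥-elim (px⇒¬qx _ _)
  ... | true  | false | _      = cong suc (count-∨ disjoint xs)
  ... | false | true  | _      = trans (cong suc (count-∨ disjoint xs)) (≡.sym (ℕ.+-suc _ _))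
  ... | false | false | _      = count-∨ disjoint xs

  count-congᴬ : ∀ {xs} → All (λ x → p x ≡ q x) xs → count p xs ≡ count q xs
  count-congᴬ {[]}     []             = refl
  count-congᴬ {x ∷ xs} (px≡qx ∷ eqs) rewrite px≡qx with q x
  ... | true  = cong suc (count-congᴬ eqs)
  ... | false = count-congᴬ eqs

count-split : ∀ {A : Set} (p s : A → Bool) xs →
              count p xs ≡ count (λ x → p x ∧ s x) xs + count (λ x → p x ∧ not (s x)) xs
count-split p s [] = refl
count-split p s (x ∷ xs) with p x | s x
... | true  | true  = cong suc (count-split p s xs)
... | true  | false = trans (cong suc (count-split p s xs)) (≡.sym (ℕ.+-suc _ _))
... | false | _     = count-split p s xs

count-map-++ : ∀ {A B : Set} (p : B → Bool) (f : A → B) xs ys →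
               count p (map f xs ++ ys) ≡ count (λ x → p (f x)) xs + count p ys
count-map-++ p f []       ys = refl
count-map-++ p f (x ∷ xs) ys with p (f x)
... | true  = cong suc (count-map-++ p f xs ys)
... | false = count-map-++ p f xs ys

count-∷-reject : ∀ {A : Set} {p : A → Bool} {x} xs → p x ≡ false →
                 count p (x ∷ xs) ≡ count p xs
count-∷-reject xs px≡false rewrite px≡false = refl

count-false : ∀ {A : Set} (xs : List A) → count (λ _ → false) xs ≡ 0
count-false []       = refl
count-false (x ∷ xs) = count-false xs

module _ {A : Set} (key : A → ℕ) (S : A → Bool) where

  ascending : A × A → Bool
  ascending (u , w) = (key u <ᵇ key w) ∧ S u ∧ S w

  T-ascending : ∀ {u w} → T (ascending (u , w)) → key u < key w × T (S u) × T (S w)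
  T-ascending {u} {w} t =
    let u<w , Su∧Sw = to (T-∧ {key u <ᵇ key w}) t
    in  ℕ.<ᵇ⇒< (key u) (key w) u<w , to (T-∧ {S u}) Su∧Sw

  ascending-< : ∀ {u w} → key u < key w → ascending (u , w) ≡ S u ∧ S w
  ascending-< {u} {w} u<w rewrite dec-true (key u ℕ.<? key w) u<w = refl

  ascending-≥ : ∀ {u w} → key w ≤ key u → ascending (u , w) ≡ false
  ascending-≥ {u} {w} w≤u rewrite dec-false (key u ℕ.<? key w) (ℕ.≤⇒≯ w≤u) = refl

  count-ascending-∷ʳ : ∀ {x xs} ys → All (λ u → key x < key u) xs →
    count ascending (cartesianProduct xs (x ∷ ys)) ≡ count ascending (cartesianProduct xs ys)
  count-ascending-∷ʳ ys [] = refl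
  count-ascending-∷ʳ {x} {u ∷ xs} ys (x<u ∷ x<xs) = begin
    count ascending (cartesianProduct (u ∷ xs) (x ∷ ys))
      ≡⟨ count-map-++ ascending (u ,_) (x ∷ ys) _ ⟩
    count (λ w → ascending (u , w)) (x ∷ ys) + count ascending (cartesianProduct xs (x ∷ ys))
      ≡⟨ cong₂ _+_ (count-∷-reject ys (ascending-≥ (ℕ.<⇒≤ x<u)))
                   (count-ascending-∷ʳ ys x<xs) ⟩
    count (λ w → ascending (u , w)) ys + count ascending (cartesianProduct xs ys)
      ≡⟨ count-map-++ ascending (u ,_) ys _ ⟨
    count ascending (cartesianProduct (u ∷ xs) ys) ∎
    where open ≡-Reasoning

  count-ascending : ∀ {xs} → AllPairs (λ u w → key u < key w) xs →
                    count ascending (cartesianProduct xs xs) ≡ count S xs C 2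
  count-ascending {[]}     []                = refl
  count-ascending {x ∷ xs} (x<xs ∷ ascending-xs) = begin
    count ascending (cartesianProduct (x ∷ xs) (x ∷ xs))
      ≡⟨ count-map-++ ascending (x ,_) (x ∷ xs) _ ⟩
    count (λ w → ascending (x , w)) (x ∷ xs) + count ascending (cartesianProduct xs (x ∷ xs))
      ≡⟨ cong₂ _+_ row (trans (count-ascending-∷ʳ xs x<xs) (count-ascending ascending-xs)) ⟩
    count (λ w → S x ∧ S w) xs + count S xs C 2
      ≡⟨ new-pairs ⟩
    count S (x ∷ xs) C 2 ∎
    where
    open ≡-Reasoning
    row : count (λ w → ascending (x , w)) (x ∷ xs) ≡ count (λ w → S x ∧ S w) xs
    row = trans (count-∷-reject xs (ascending-≥ ℕ.≤-refl)) (count-congᴬ (All.map ascending-< x<xs))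
    new-pairs : count (λ w → S x ∧ S w) xs + count S xs C 2 ≡ count S (x ∷ xs) C 2
    new-pairs with S x
    ... | true  = ≡.sym ([1+m]C2≡m+mC2 (count S xs))
    ... | false = cong (_+ count S xs C 2) (count-false xs)

Edge-sym : ∀ {n} (G : SimpleGraph n) {u w} → Edge G u w → Edge G w u
Edge-sym G {u} {w} = subst T (SimpleGraph.sym G u w)

module _ {n} (G : SimpleGraph n) (v : Fin n) where

  record NeighbourClique (S : Fin n → Bool) : Set where
    field
      neighbour : ∀ {u} → T (S u) → Edge G v u
      adjacent  : ∀ {u w} → T (S u) → T (S w) → u ≢ w → Edge G u w

  T-linked : ∀ {u w} → toℕ u < toℕ w → Edge G v u → Edge G v w → Edge G u w →
             T ((toℕ u <ᵇ toℕ w) ∧ adj G v u ∧ adj G v w ∧ adj G u w)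
  T-linked {u} {w} u<w vu vw uw =
    from (T-∧ {toℕ u <ᵇ toℕ w})
      (ℕ.<⇒<ᵇ u<w , from (T-∧ {adj G v u}) (vu , from (T-∧ {adj G v w}) (vw , uw)))

  ascending-linked : ∀ {S} → NeighbourClique S → ∀ {u w} → T (ascending toℕ S (u , w)) →
                     T ((toℕ u <ᵇ toℕ w) ∧ adj G v u ∧ adj G v w ∧ adj G u w)
  ascending-linked {S} clique {u} {w} t with u<w , Su , Sw ← T-ascending toℕ S {u} {w} t =
    T-linked {u} {w} u<w (neighbour Su) (neighbour Sw)
      (adjacent Su Sw (λ { refl → ℕ.<-irrefl refl u<w }))
    where open NeighbourClique clique

  disjoint-cliques-≤-linked : ∀ {S S′} → NeighbourClique S → NeighbourClique S′ →
    (∀ {u} → T (S u) → ¬ T (S′ u)) →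
    count S (allFin n) C 2 + count S′ (allFin n) C 2 ≤ linkedNeighbourPairs G v
  disjoint-cliques-≤-linked {S} {S′} clique clique′ disjoint = begin
    count S (allFin n) C 2 + count S′ (allFin n) C 2
      ≡⟨ cong₂ _+_ (count-ascending toℕ S sorted) (count-ascending toℕ S′ sorted) ⟨
    count (ascending toℕ S) pairs + count (ascending toℕ S′) pairs
      ≡⟨ count-∨ (λ {x} → ascending-disjoint x) pairs ⟨
    count (λ x → ascending toℕ S x ∨ ascending toℕ S′ x) pairs
      -- the target is the predicate local to linkedNeighbourPairs, reachable only by
      -- unification; splitting the pair lets its body reduce
      ≤⟨ count-mono-≤ (λ { {u , w} t → [ ascending-linked clique {u} {w}
                                         , ascending-linked clique′ {u} {w}
                                         ]′ (to (T-∨ {ascending toℕ S (u , w)}) t) })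
                      pairs ⟩
    linkedNeighbourPairs G v ∎
    where
    open ℕ.≤-Reasoning
    pairs : List (Fin n × Fin n)
    pairs = cartesianProduct (allFin n) (allFin n)
    sorted : AllPairs (λ i j → toℕ i < toℕ j) (allFin n)
    sorted = tabulate⁺-< (λ i<j → i<j)
    ascending-disjoint : ∀ x → T (ascending toℕ S x) → ¬ T (ascending toℕ S′ x)
    ascending-disjoint (u , w) tS tS′ = disjoint (proj₁ (proj₂ (T-ascending toℕ S {u} {w} tS)))
                                                 (proj₁ (proj₂ (T-ascending toℕ S′ {u} {w} tS′)))

module _ {n} (G : SimpleGraph n) (σ : Labeling n) (v : Fin n) where

  private
    lab : Fin n → ℕ
    lab x = toℕ (Bijection.to σ x)

  below above : Fin n → Bool
  below u = adj G v u ∧ (lab u <ᵇ lab v)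
  above u = adj G v u ∧ not (lab u <ᵇ lab v)

  degree-≡-below+above : degree G v ≡ count below (allFin n) + count above (allFin n)
  degree-≡-below+above = count-split (adj G v) (λ u → lab u <ᵇ lab v) (allFin n)

  below-neighbour : ∀ {u} → T (below u) → Edge G v u
  below-neighbour {u} t = proj₁ (to (T-∧ {adj G v u}) t)

  above-neighbour : ∀ {u} → T (above u) → Edge G v u
  above-neighbour {u} t = proj₁ (to (T-∧ {adj G v u}) t)

  below-label : ∀ {u} → T (below u) → lab u < lab v
  below-label {u} t = ℕ.<ᵇ⇒< (lab u) (lab v) (proj₂ (to (T-∧ {adj G v u}) t))

  above-label-≮ : ∀ {u} → T (above u) → ¬ lab u < lab v
  above-label-≮ {u} t u<v =
    subst T (to T-not-≡ (proj₂ (to (T-∧ {adj G v u}) t))) (ℕ.<⇒<ᵇ u<v)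

  neighbour-label-≢ : ∀ {u} → Edge G v u → lab v ≢ lab u
  neighbour-label-≢ {u} vu lv≡lu with Bijection.injective σ (Fin.toℕ-injective lv≡lu)
  ... | refl = subst T (irrefl G v) vu

  above-label : ∀ {u} → T (above u) → lab v < lab u
  above-label t =
    ℕ.≤∧≢⇒< (ℕ.≮⇒≥ (above-label-≮ t)) (neighbour-label-≢ (above-neighbour t))

  below-above-disjoint : ∀ {u} → T (below u) → ¬ T (above u)
  below-above-disjoint tb ta = above-label-≮ ta (below-label tb)

  module _ (closed : IsClosedLabeling G σ) where

    below-clique : NeighbourClique G v below
    below-clique = record
      { neighbour = below-neighbour
      ; adjacent  = λ tu tw u≢w →
          closed _ v _ (Edge-sym G (below-neighbour tu)) (below-neighbour tw) u≢w
                 (inj₂ (below-label tu , below-label tw))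
      }

    above-clique : NeighbourClique G v above
    above-clique = record
      { neighbour = above-neighbour
      ; adjacent  = λ tu tw u≢w →
          closed _ v _ (Edge-sym G (above-neighbour tu)) (above-neighbour tw) u≢w
                 (inj₁ (above-label tu , above-label tw))
      }

    closed⇒degree-square≤ : degree G v * degree G v ≤ 4 * linkedNeighbourPairs G v + 2 * degree G v
    closed⇒degree-square≤ =
      subst (λ d → d * d ≤ 4 * linkedNeighbourPairs G v + 2 * d) (≡.sym degree-≡-below+above)
        (C2+C2≤⇒square≤ (count below (allFin n)) (count above (allFin n))
          (disjoint-cliques-≤-linked G v below-clique above-clique below-above-disjoint))

fromℚᵘ-mono-≤ : ∀ {p q} → p ≤ᵘ q → fromℚᵘ p ≤ℚ fromℚᵘ q
fromℚᵘ-mono-≤ {p} {q} p≤q = ℚ.toℚᵘ-cancel-≤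
  (ℚᵘ.≤-respˡ-≃ (ℚᵘ.≃-sym (ℚ.toℚᵘ-fromℚᵘ p))
    (ℚᵘ.≤-respʳ-≃ (ℚᵘ.≃-sym (ℚ.toℚᵘ-fromℚᵘ q)) p≤q))

/-mono-≤ : ∀ a b c d .{{_ : ℕ.NonZero b}} .{{_ : ℕ.NonZero d}} →
           a * d ≤ c * b → + a / b ≤ℚ + c / d
/-mono-≤ a b@(suc b-1) c d@(suc d-1) ad≤cb = fromℚᵘ-mono-≤ {mkℚᵘ (+ a) b-1} {mkℚᵘ (+ c) d-1}
  (*≤* (subst₂ ℤ._≤_ (ℤ.pos-* a d) (ℤ.pos-* c b) (+≤+ ad≤cb)))

/-+-/ : ∀ a b c d → + a / suc b ℚ.+ + c / suc d ≡ + (a * suc d + c * suc b) / (suc b * suc d)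
/-+-/ a b c d = ℚ.toℚᵘ-injective (begin-equality
    toℚᵘ (x ℚ.+ y)
      ≃⟨ ℚ.toℚᵘ-homo-+ x y ⟩
    toℚᵘ x ℚᵘ.+ toℚᵘ y
      ≃⟨ ℚᵘ.+-cong (ℚ.toℚᵘ-fromℚᵘ (mkℚᵘ (+ a) b)) (ℚ.toℚᵘ-fromℚᵘ (mkℚᵘ (+ c) d)) ⟩
    mkℚᵘ (+ a) b ℚᵘ.+ mkℚᵘ (+ c) d
      ≡⟨ cong (λ z → mkℚᵘ z (d + b * suc d)) numerator ⟩
    mkℚᵘ (+ (a * suc d + c * suc b)) (d + b * suc d)
      ≃⟨ ℚᵘ.≃-sym (ℚ.toℚᵘ-fromℚᵘ _) ⟩
    toℚᵘ (+ (a * suc d + c * suc b) / (suc b * suc d)) ∎)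
  where
  open ℚᵘ.≤-Reasoning
  x y : ℚ
  x = + a / suc b
  y = + c / suc d
  numerator : + a ℤ.* + suc d ℤ.+ + c ℤ.* + suc b ≡ + (a * suc d + c * suc b)
  numerator = trans (cong₂ ℤ._+_ (≡.sym (ℤ.pos-* a (suc d))) (≡.sym (ℤ.pos-* c (suc b))))
                    (≡.sym (ℤ.pos-+ (a * suc d) (c * suc b)))

p≤q+r⇒p-r≤q : ∀ p q r → p ≤ℚ q ℚ.+ r → p - r ≤ℚ q
p≤q+r⇒p-r≤q p q r p≤q+r = begin
  p - r           ≤⟨ ℚ.+-monoˡ-≤ (ℚ.- r) p≤q+r ⟩
  (q ℚ.+ r) - r   ≡⟨ ℚ.+-assoc q r (ℚ.- r) ⟩
  q ℚ.+ (r - r)   ≡⟨ cong (q ℚ.+_) (ℚ.+-inverseʳ r) ⟩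
  q ℚ.+ ℚ.0ℚ      ≡⟨ ℚ.+-identityʳ q ⟩
  q               ∎
  where open ℚ.≤-Reasoning

lowerBound-≤ : ∀ k → lowerBound (2 + k) ≤ℚ + k / (2 * suc k)
lowerBound-≤ k = p≤q+r⇒p-r≤q ½ (+ k / (2 * suc k)) (+ 1 / (2 * suc k))
    (subst (½ ≤ℚ_) (≡.sym (/-+-/ k b 1 b))
      (/-mono-≤ 1 2 (k * suc b + 1 * suc b) (suc b * suc b) (≤-reflexive (halves k))))
  where
  b : ℕ
  b = ℕ.pred (2 * suc k)
  halves : ∀ k → 1 * (2 * suc k * (2 * suc k)) ≡ (k * (2 * suc k) + 1 * (2 * suc k)) * 2
  halves = solve-∀

lowerBound-≤-cross : ∀ k e P → 2 * P ≡ (2 + k) * suc k → k * (2 + k) ≤ 4 * e →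
                     k * P ≤ e * (2 * suc k)
lowerBound-≤-cross k e P twoP k[2+k]≤4e = *-cancelˡ-≤ 2 (begin
  2 * (k * P)             ≡⟨ swap k P ⟩
  k * (2 * P)             ≡⟨ cong (k *_) twoP ⟩
  k * ((2 + k) * suc k)   ≡⟨ ℕ.*-assoc k (2 + k) (suc k) ⟨
  k * (2 + k) * suc k     ≤⟨ *-monoˡ-≤ (suc k) k[2+k]≤4e ⟩
  4 * e * suc k           ≡⟨ regroup k e ⟩
  2 * (e * (2 * suc k))   ∎)
  where
  open ℕ.≤-Reasoning
  swap : ∀ k P → 2 * (k * P) ≡ k * (2 * P)
  swap = solve-∀
  regroup : ∀ k e → 4 * e * suc k ≡ 2 * (e * (2 * suc k))
  regroup = solve-∀

third-≤-cross : ∀ k e P → 2 * P ≡ (2 + k) * suc k → k * (2 + k) ≤ 4 * e → 1 ≤ k →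
                1 * P ≤ e * 3
third-≤-cross 1 zero    P twoP ()
third-≤-cross 1 (suc e) P twoP _ _ = begin
  1 * P      ≡⟨ ℕ.*-identityˡ P ⟩
  P          ≡⟨ ℕ.*-cancelˡ-≡ P 3 2 twoP ⟩
  3          ≤⟨ ℕ.m≤n*m 3 (suc e) ⟩
  suc e * 3  ∎
  where open ℕ.≤-Reasoning
third-≤-cross (suc (suc j)) e P twoP k[2+k]≤4e _ = *-cancelˡ-≤ 4 (begin
  4 * (1 * P)                     ≡⟨ double (1 * P) ⟩
  2 * (2 * (1 * P))               ≡⟨ cong (λ x → 2 * (2 * x)) (ℕ.*-identityˡ P) ⟩
  2 * (2 * P)                     ≡⟨ cong (2 *_) twoP ⟩
  2 * ((4 + j) * (3 + j))         ≤⟨ ℕ.m≤m+n _ (j * (4 + j)) ⟩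
  2 * ((4 + j) * (3 + j)) + j * (4 + j) ≡⟨ gap j ⟩
  3 * ((2 + j) * (4 + j))         ≤⟨ *-monoʳ-≤ 3 k[2+k]≤4e ⟩
  3 * (4 * e)                     ≡⟨ regroup e ⟩
  4 * (e * 3)                     ∎)
  where
  open ℕ.≤-Reasoning
  double : ∀ x → 4 * x ≡ 2 * (2 * x)
  double = solve-∀
  gap : ∀ j → 2 * ((4 + j) * (3 + j)) + j * (4 + j) ≡ 3 * ((2 + j) * (4 + j))
  gap = solve-∀
  regroup : ∀ e → 3 * (4 * e) ≡ 4 * (e * 3)
  regroup = solve-∀

-- d * d ≤ 4 * e + 2 * d is 4e ≥ d(d − 2) without truncated subtraction.
clustering-bounds : ∀ d e → 2 ≤ d → d * d ≤ 4 * e + 2 * d →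
  (lowerBound d ≤ℚ ratio e (d C 2)) × (3 ≤ d → + 1 / 3 ≤ℚ ratio e (d C 2))
clustering-bounds (suc (suc k)) e (s≤s (s≤s z≤n)) d²≤4e+2d
  with suc (suc k) C 2 | 2*[1+m]C2≡[1+m]*m (suc k)
... | suc p | twoP =
    ℚ.≤-trans (lowerBound-≤ k)
      (/-mono-≤ k (2 * suc k) e (suc p) (lowerBound-≤-cross k e (suc p) twoP k[2+k]≤4e))
  , λ { (s≤s (s≤s 1≤k)) → /-mono-≤ 1 3 e (suc p) (third-≤-cross k e (suc p) twoP k[2+k]≤4e 1≤k) }
  where
  expand : ∀ k → (2 + k) * (2 + k) ≡ k * (2 + k) + 2 * (2 + k)
  expand = solve-∀
  k[2+k]≤4e : k * (2 + k) ≤ 4 * e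
  k[2+k]≤4e = +-cancelʳ-≤ (2 * (2 + k)) (k * (2 + k)) (4 * e)
                (subst (_≤ 4 * e + 2 * (2 + k)) (expand k) d²≤4e+2d)

proposition6p1 : ∀ {n : ℕ} (G : SimpleGraph n) → IsClosed G → (v : Fin n) → 2 ≤ degree G v →
    (lowerBound (degree G v) ≤ℚ clustering G v) × (3 ≤ degree G v → (+ 1 / 3) ≤ℚ clustering G v)
proposition6p1 G (σ , closed) v 2≤d =
  clustering-bounds (degree G v) (linkedNeighbourPairs G v) 2≤d (closed⇒degree-square≤ G σ v closed)
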